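{- For any integer $d\ge 2$ and any $k\in\{2,2^2,\dots,2^d\}$, $\operatorname{msad}_k(T_d)\le \sum_{i=1}^{\log_2 k} d^{\,i-1}$.
   Context: For $d\ge 1$, $T_d$ is the complete binary tree of height $d$: a tree with a root $r$ of degree 2, all leaves at distance exactly $d$ from $r$, and every other vertex of degree 3. For a connected graph $G$, $S\subseteq V(G)$ and $v\in V(G)$, $m(v|S)$ is the multiset $\{\!\{d_G(v,s): s\in S\}\!\}$ of shortest-path distances. A nonempty set $S\subsetneq V(G)$ is a $k$-multiset antiresolving set ($k$-MARS) if $k$ equals the minimum size of an equivalence class of the relation on $V(G)\setminus S$ given by $u\sim v \iff m(u|S)=m(v|S)$. $\operatorname{msad}_k(G)$ is the minimum cardinality of a $k$-MARS of $G$ (and $\infty$ if none exists). -}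

module Defs where

open import Data.Bool using (Bool; true; false; _∧_)
open import Data.Bool.Properties using () renaming (_≟_ to _≟ᵇ_)
open import Data.List using (List; []; _∷_; length; map)
open import Data.List.Membership.Propositional using (_∈_; _∉_)
open import Data.List.Relation.Unary.Unique.Propositional using (Unique)
open import Data.List.Relation.Binary.Permutation.Propositional using (_↭_)
open import Data.Nat using (ℕ; zero; suc; _+_; _*_; _∸_; _^_; _≤_)
open import Data.Product using (Σ; ∃; _×_; _,_; proj₁)
open import Function.Bundles using (_⇔_)
open import Relation.Nullary using (¬_; yes; no)
open import Relation.Binary.PropositionalEquality using (_≡_)

-- Vertices of the complete binary tree T_d: binary words of length ≤ d.
-- The empty word is the root r; the children of w are w ++ [false] and
-- w ++ [true] (here words are read from the root downwards).
-- Edges: w — w ++ [b].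
Vertex : ℕ → Set
Vertex d = Σ (List Bool) (λ w → length w ≤ d)

lcp : List Bool → List Bool → ℕ
lcp (a ∷ u) (b ∷ v) with a ≟ᵇ b
... | yes _ = suc (lcp u v)
... | no  _ = zero
lcp _ _ = zero

-- shortest-path distance in T_d: the path between u and v goes through
-- their deepest common ancestor (= longest common prefix).
dist : ∀ {d} → Vertex d → Vertex d → ℕ
dist (u , _) (v , _) = (length u + length v) ∸ (2 * lcp u v)

-- m(v|S) as a list of distances; multisets are compared up to permutation.
m : ∀ {d} → Vertex d → List (Vertex d) → List ℕ
m v S = map (dist v) S

_~⟨_⟩_ : ∀ {d} → Vertex d → List (Vertex d) → Vertex d → Set
u ~⟨ S ⟩ w = m u S ↭ m w S

ClassSize : ∀ {d} → List (Vertex d) → Vertex d → ℕ → Set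
ClassSize {d} S u n =
  Σ (List (Vertex d)) λ C →
    Unique C × (∀ w → (w ∈ C) ⇔ ((w ∉ S) × (w ~⟨ S ⟩ u))) × length C ≡ n

IsMARS : ∀ d → ℕ → List (Vertex d) → Set
IsMARS d k S =
  Unique S
  × (∃ λ s → s ∈ S)
  × (∃ λ v → v ∉ S)
  × (∃ λ u → u ∉ S × ClassSize S u k)
  × (∀ u n → u ∉ S → ClassSize S u n → k ≤ n)

msad≤ : ℕ → ℕ → ℕ → Set
msad≤ d k b = Σ (List (Vertex d)) λ S → IsMARS d k S × length S ≤ b

geomSum : ℕ → ℕ → ℕ
geomSum d zero    = zero
geomSum d (suc j) = geomSum d j + d ^ j

{-# OPTIONS --safe #-}
-- Take S to be the 2 ^ j - 1 vertices of depth < j; since d ≥ 2 this is at most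
-- Σ_{i=1}^{j} d^(i-1).  For a vertex outside S, the multiset of its distances to S
-- depends only on its depth t (the two subtrees below any vertex may be swapped), and
-- conversely determines t, because its minimum t - (j - 1) is attained at the
-- ancestor of depth j - 1.  Hence the classes are the levels t = j, …, d, of
-- sizes 2 ^ t, and the smallest one has 2 ^ j elements.
module Submission where

open import Defs
open import Data.Nat using (ℕ; zero; suc; _+_; _*_; _∸_; _^_; _≤_; _<_; z≤n; s≤s)
open import Data.Nat.Properties
open import Data.Bool using (Bool; true; false)
open import Data.List using (List; []; _∷_; [_]; length; map; _++_; take; replicate)
open import Data.List.Properties using (∷-injectiveʳ; length-++; length-map; length-take; length-replicate; map-++; map-∘)
open import Data.List.Membership.Propositional using (_∈_; _∉_)
open import Data.List.Membership.Propositional.Properties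
  using (∈-map⁺; ∈-map⁻; ∈-++⁺ˡ; ∈-++⁺ʳ; ∈-++⁻; ∈-∃++)
open import Data.List.Relation.Binary.Subset.Propositional using (_⊆_)
open import Data.List.Relation.Unary.Any using (here; there)
open import Data.List.Relation.Unary.All as All using (All; []; _∷_)
open import Data.List.Relation.Unary.AllPairs using ([]; _∷_)
open import Data.List.Relation.Unary.Unique.Propositional using (Unique)
import Data.List.Relation.Unary.Unique.Propositional.Properties as Unique
open import Data.List.Relation.Binary.Permutation.Propositional
  using (_↭_; ↭-refl; ↭-sym; ↭-trans; ↭-reflexive; module PermutationReasoning)
open import Data.List.Relation.Binary.Permutation.Propositional.Properties
  using (∈-resp-↭; ++-comm) renaming (++⁺ to ↭-++⁺)
open import Data.Product using (∃; _×_; _,_; proj₁)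
open import Data.Sum using (inj₁; inj₂)
open import Data.Empty using (⊥-elim)
open import Function.Base using (_∘_)
open import Function.Bundles using (_⇔_; mk⇔; Equivalence)
open import Function.Construct.Composition using (_⇔-∘_)
open import Function.Construct.Symmetry using (⇔-sym)
open import Relation.Nullary using (¬_; yes; no)
open import Relation.Binary.PropositionalEquality
  using (_≡_; refl; sym; trans; cong; cong₂; subst; subst₂; module ≡-Reasoning)

viaRoot : ℕ → List Bool → ℕ
viaRoot n v = suc n + suc (length v)

wordDist : List Bool → List Bool → ℕ
wordDist []          v           = length v
wordDist (_ ∷ u)     []          = suc (length u)
wordDist (false ∷ u) (false ∷ v) = wordDist u v
wordDist (true ∷ u)  (true ∷ v)  = wordDist u v
wordDist (false ∷ u) (true ∷ v)  = viaRoot (length u) v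
wordDist (true ∷ u)  (false ∷ v) = viaRoot (length u) v

wordDist-[]ʳ : ∀ u → wordDist u [] ≡ length u
wordDist-[]ʳ []      = refl
wordDist-[]ʳ (_ ∷ _) = refl

suc+suc∸2*suc : ∀ a b c → (suc a + suc b) ∸ 2 * suc c ≡ (a + b) ∸ 2 * c
suc+suc∸2*suc a b c = cong₂ _∸_ (+-suc a b) (+-suc c (c + 0))

lcpDist≡wordDist : ∀ u v → (length u + length v) ∸ 2 * lcp u v ≡ wordDist u v
lcpDist≡wordDist []          v           = refl
lcpDist≡wordDist (_ ∷ u)     []          = +-identityʳ _
lcpDist≡wordDist (false ∷ u) (false ∷ v) =
  trans (suc+suc∸2*suc (length u) (length v) (lcp u v)) (lcpDist≡wordDist u v)
lcpDist≡wordDist (true ∷ u)  (true ∷ v)  =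
  trans (suc+suc∸2*suc (length u) (length v) (lcp u v)) (lcpDist≡wordDist u v)
lcpDist≡wordDist (false ∷ u) (true ∷ v)  = refl
lcpDist≡wordDist (true ∷ u)  (false ∷ v) = refl

module _ {d : ℕ} where

  Fits : List Bool → Set
  Fits w = length w ≤ d

  -- Words longer than d are sent to the root, a junk value: toVertex is only applied
  -- to lists of words that fit.
  toVertex : List Bool → Vertex d
  toVertex w with length w ≤? d
  ... | yes w≤d = w , w≤d
  ... | no  _   = [] , z≤n

  toVertex-proj₁ : ∀ (v : Vertex d) → toVertex (proj₁ v) ≡ v
  toVertex-proj₁ (w , w≤d) with length w ≤? d
  ... | yes w≤d′ = cong (w ,_) (≤-irrelevant w≤d′ w≤d)
  ... | no  w≰d  = ⊥-elim (w≰d w≤d)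

  proj₁-toVertex : ∀ {w} → Fits w → proj₁ (toVertex w) ≡ w
  proj₁-toVertex w≤d = cong proj₁ (toVertex-proj₁ (_ , w≤d))

  map-proj₁-toVertex : ∀ {L} → All Fits L → map proj₁ (map toVertex L) ≡ L
  map-proj₁-toVertex []           = refl
  map-proj₁-toVertex (w≤d ∷ fits) = cong₂ _∷_ (proj₁-toVertex w≤d) (map-proj₁-toVertex fits)

  Unique-map-toVertex : ∀ {L} → All Fits L → Unique L → Unique (map toVertex L)
  Unique-map-toVertex fits uniq = Unique.map⁻ (subst Unique (sym (map-proj₁-toVertex fits)) uniq)

  ∈-map-toVertex⁺ : ∀ {L} {v : Vertex d} → proj₁ v ∈ L → v ∈ map toVertex L
  ∈-map-toVertex⁺ {v = v} w∈L = subst (_∈ _) (toVertex-proj₁ v) (∈-map⁺ toVertex w∈L)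

  ∈-map-toVertex⁻ : ∀ {L} → All Fits L → ∀ {v} → v ∈ map toVertex L → proj₁ v ∈ L
  ∈-map-toVertex⁻ fits v∈ with ∈-map⁻ toVertex v∈
  ... | w , w∈L , refl = subst (_∈ _) (sym (proj₁-toVertex (All.lookup fits w∈L))) w∈L

  m-map-toVertex : ∀ (v : Vertex d) {L} → All Fits L → m v (map toVertex L) ≡ map (wordDist (proj₁ v)) L
  m-map-toVertex v []           = refl
  m-map-toVertex v (w≤d ∷ fits) = cong₂ _∷_
    (trans (lcpDist≡wordDist (proj₁ v) _) (cong (wordDist (proj₁ v)) (proj₁-toVertex w≤d)))
    (m-map-toVertex v fits)

  depth : Vertex d → ℕ
  depth = length ∘ proj₁

level : ℕ → List (List Bool)
level zero    = [ [] ]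
level (suc i) = map (false ∷_) (level i) ++ map (true ∷_) (level i)

∈-level⁻ : ∀ i {w} → w ∈ level i → length w ≡ i
∈-level⁻ zero    (here refl) = refl
∈-level⁻ (suc i) w∈ with ∈-++⁻ (map (false ∷_) (level i)) w∈
... | inj₁ w∈₀ with ∈-map⁻ (false ∷_) w∈₀
...   | _ , x∈ , refl = cong suc (∈-level⁻ i x∈)
∈-level⁻ (suc i) w∈ | inj₂ w∈₁ with ∈-map⁻ (true ∷_) w∈₁
...   | _ , x∈ , refl = cong suc (∈-level⁻ i x∈)

∈-level⁺ : ∀ w → w ∈ level (length w)
∈-level⁺ []          = here refl
∈-level⁺ (false ∷ w) = ∈-++⁺ˡ (∈-map⁺ (false ∷_) (∈-level⁺ w))
∈-level⁺ (true ∷ w)  = ∈-++⁺ʳ (map (false ∷_) (level (length w))) (∈-map⁺ (true ∷_) (∈-level⁺ w))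

Unique-level : ∀ i → Unique (level i)
Unique-level zero    = [] ∷ []
Unique-level (suc i) =
  Unique.++⁺ (Unique.map⁺ ∷-injectiveʳ (Unique-level i)) (Unique.map⁺ ∷-injectiveʳ (Unique-level i)) disjoint
  where
  disjoint : ∀ {w} → ¬ (w ∈ map (false ∷_) (level i) × w ∈ map (true ∷_) (level i))
  disjoint (w∈₀ , w∈₁) with ∈-map⁻ (false ∷_) w∈₀ | ∈-map⁻ (true ∷_) w∈₁
  ... | _ , _ , refl | _ , _ , ()

length-level : ∀ i → length (level i) ≡ 2 ^ i
length-level zero    = refl
length-level (suc i) = begin
  length (map (false ∷_) (level i) ++ map (true ∷_) (level i))
    ≡⟨ length-++ (map (false ∷_) (level i)) ⟩
  length (map (false ∷_) (level i)) + length (map (true ∷_) (level i))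
    ≡⟨ cong₂ _+_ (length-map (false ∷_) (level i)) (length-map (true ∷_) (level i)) ⟩
  length (level i) + length (level i)
    ≡⟨ cong (λ n → n + n) (length-level i) ⟩
  2 ^ i + 2 ^ i
    ≡⟨ cong (2 ^ i +_) (sym (+-identityʳ (2 ^ i))) ⟩
  2 ^ suc i ∎
  where open ≡-Reasoning

below : ℕ → List (List Bool)
below zero    = []
below (suc j) = below j ++ level j

∈-below⁻ : ∀ j {w} → w ∈ below j → length w < j
∈-below⁻ (suc j) w∈ with ∈-++⁻ (below j) w∈
... | inj₁ w∈< = m≤n⇒m≤1+n (∈-below⁻ j w∈<)
... | inj₂ w∈= = ≤-reflexive (cong suc (∈-level⁻ j w∈=))

∈-below⁺ : ∀ j {w} → length w < j → w ∈ below j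
∈-below⁺ (suc j) {w} (s≤s |w|≤j) with m≤n⇒m<n∨m≡n |w|≤j
... | inj₁ |w|<j = ∈-++⁺ˡ (∈-below⁺ j |w|<j)
... | inj₂ refl  = ∈-++⁺ʳ (below j) (∈-level⁺ w)

Unique-below : ∀ j → Unique (below j)
Unique-below zero    = []
Unique-below (suc j) = Unique.++⁺ (Unique-below j) (Unique-level j)
  (λ (w∈< , w∈=) → <-irrefl (∈-level⁻ j w∈=) (∈-below⁻ j w∈<))

length-below : ∀ j → length (below j) ≡ geomSum 2 j
length-below zero    = refl
length-below (suc j) = begin
  length (below j ++ level j)          ≡⟨ length-++ (below j) ⟩
  length (below j) + length (level j)  ≡⟨ cong₂ _+_ (length-below j) (length-level j) ⟩
  geomSum 2 j + 2 ^ j                  ∎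
  where open ≡-Reasoning

geomSum-monoˡ-≤ : ∀ {c d} j → c ≤ d → geomSum c j ≤ geomSum d j
geomSum-monoˡ-≤ zero    c≤d = z≤n
geomSum-monoˡ-≤ (suc j) c≤d = +-mono-≤ (geomSum-monoˡ-≤ j c≤d) (^-monoˡ-≤ j c≤d)

-- The distances from b ∷ v to level (suc i) are those from v to level i (within b's
-- subtree) together with those through the root, which depend on v only through its length.
map-wordDist-level-↭ : ∀ i u u′ → length u ≡ length u′ →
  map (wordDist u) (level i) ↭ map (wordDist u′) (level i)
map-wordDist-level-↭ zero u u′ |u|≡|u′| =
  ↭-reflexive (cong [_] (trans (wordDist-[]ʳ u) (trans |u|≡|u′| (sym (wordDist-[]ʳ u′)))))
map-wordDist-level-↭ (suc i) []      []       _        = ↭-refl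
map-wordDist-level-↭ (suc i) (a ∷ v) (a′ ∷ v′) |u|≡|u′| = begin
  map (wordDist (a ∷ v)) (level (suc i))
    ↭⟨ halves a v ⟩
  map (wordDist v) W ++ map (viaRoot (length v)) W
    ↭⟨ ↭-++⁺ (map-wordDist-level-↭ i v v′ |v|≡|v′|) (↭-reflexive (cong (λ n → map (viaRoot n) W) |v|≡|v′|)) ⟩
  map (wordDist v′) W ++ map (viaRoot (length v′)) W
    ↭⟨ halves a′ v′ ⟨
  map (wordDist (a′ ∷ v′)) (level (suc i)) ∎
  where
  open PermutationReasoning
  W : List (List Bool)
  W = level i
  |v|≡|v′| : length v ≡ length v′
  |v|≡|v′| = suc-injective |u|≡|u′|
  split : ∀ b v → map (wordDist (b ∷ v)) (level (suc i))
                ≡ map (wordDist (b ∷ v) ∘ (false ∷_)) W ++ map (wordDist (b ∷ v) ∘ (true ∷_)) W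
  split b v = trans (map-++ (wordDist (b ∷ v)) (map (false ∷_) W) _)
                    (cong₂ _++_ (sym (map-∘ W)) (sym (map-∘ W)))
  halves : ∀ b v → map (wordDist (b ∷ v)) (level (suc i))
                 ↭ map (wordDist v) W ++ map (viaRoot (length v)) W
  halves false v = ↭-reflexive (split false v)
  halves true  v = ↭-trans (↭-reflexive (split true v)) (++-comm (map (viaRoot (length v)) W) _)

map-wordDist-below-↭ : ∀ j u u′ → length u ≡ length u′ →
  map (wordDist u) (below j) ↭ map (wordDist u′) (below j)
map-wordDist-below-↭ zero    _ _  _        = ↭-refl
map-wordDist-below-↭ (suc j) u u′ |u|≡|u′| = begin
  map (wordDist u) (below j ++ level j)
    ≡⟨ map-++ (wordDist u) (below j) (level j) ⟩
  map (wordDist u) (below j) ++ map (wordDist u) (level j)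
    ↭⟨ ↭-++⁺ (map-wordDist-below-↭ j u u′ |u|≡|u′|) (map-wordDist-level-↭ j u u′ |u|≡|u′|) ⟩
  map (wordDist u′) (below j) ++ map (wordDist u′) (level j)
    ≡⟨ map-++ (wordDist u′) (below j) (level j) ⟨
  map (wordDist u′) (below j ++ level j) ∎
  where open PermutationReasoning

wordDist-take : ∀ k u → k ≤ length u → wordDist u (take k u) + k ≡ length u
wordDist-take zero    u           _         = trans (+-identityʳ _) (wordDist-[]ʳ u)
wordDist-take (suc k) (false ∷ u) (s≤s k≤u) = trans (+-suc _ k) (cong suc (wordDist-take k u k≤u))
wordDist-take (suc k) (true ∷ u)  (s≤s k≤u) = trans (+-suc _ k) (cong suc (wordDist-take k u k≤u))

length≤wordDist+length : ∀ u s → length u ≤ wordDist u s + length s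
length≤wordDist+length []          s           = z≤n
length≤wordDist+length (_ ∷ u)     []          = m≤m+n _ 0
length≤wordDist+length (false ∷ u) (false ∷ s) =
  ≤-trans (s≤s (length≤wordDist+length u s)) (≤-reflexive (sym (+-suc _ _)))
length≤wordDist+length (true ∷ u)  (true ∷ s)  =
  ≤-trans (s≤s (length≤wordDist+length u s)) (≤-reflexive (sym (+-suc _ _)))
length≤wordDist+length (false ∷ u) (true ∷ s)  = ≤-trans (m≤m+n _ _) (m≤m+n _ _)
length≤wordDist+length (true ∷ u)  (false ∷ s) = ≤-trans (m≤m+n _ _) (m≤m+n _ _)

-- The least distance from u to a word of length ≤ j is |u| ∸ j, attained at the prefix
-- of u of length j.
↭-below⇒length≤ : ∀ j u w → suc j ≤ length u →
  map (wordDist u) (below (suc j)) ↭ map (wordDist w) (below (suc j)) → length w ≤ length u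
↭-below⇒length≤ j u w j<|u| u↭w = bound (∈-map⁻ (wordDist w) (∈-resp-↭ u↭w x∈))
  where
  open ≤-Reasoning
  x : ℕ
  x = wordDist u (take j u)
  x∈ : x ∈ map (wordDist u) (below (suc j))
  x∈ = ∈-map⁺ (wordDist u) (∈-below⁺ (suc j) (s≤s (≤-trans (≤-reflexive (length-take j u)) (m⊓n≤m j _))))
  bound : ∃ (λ s → s ∈ below (suc j) × x ≡ wordDist w s) → length w ≤ length u
  bound (s , s∈ , x≡) = begin
    length w                 ≤⟨ length≤wordDist+length w s ⟩
    wordDist w s + length s  ≤⟨ +-monoʳ-≤ (wordDist w s) (≤-pred (∈-below⁻ (suc j) s∈)) ⟩
    wordDist w s + j         ≡⟨ cong (_+ j) x≡ ⟨
    x + j                    ≡⟨ wordDist-take j u (<⇒≤ j<|u|) ⟩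
    length u                 ∎

↭-below⇒length≡ : ∀ j u w → suc j ≤ length u → suc j ≤ length w →
  map (wordDist u) (below (suc j)) ↭ map (wordDist w) (below (suc j)) → length u ≡ length w
↭-below⇒length≡ j u w j<|u| j<|w| u↭w =
  ≤-antisym (↭-below⇒length≤ j w u j<|w| (↭-sym u↭w)) (↭-below⇒length≤ j u w j<|u| u↭w)

Unique-⊆⇒length≤ : ∀ {A : Set} {xs ys : List A} → Unique xs → xs ⊆ ys → length xs ≤ length ys
Unique-⊆⇒length≤ {xs = []}     _             _     = z≤n
Unique-⊆⇒length≤ {xs = x ∷ xs} (x∉xs ∷ uniq) xs⊆ys with ∈-∃++ (xs⊆ys (here refl))
... | as , bs , refl = begin
  suc (length xs)              ≤⟨ s≤s (Unique-⊆⇒length≤ uniq xs⊆as++bs) ⟩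
  suc (length (as ++ bs))      ≡⟨ cong suc (length-++ as) ⟩
  suc (length as + length bs)  ≡⟨ +-suc (length as) (length bs) ⟨
  length as + length (x ∷ bs)  ≡⟨ length-++ as ⟨
  length (as ++ x ∷ bs)        ∎
  where
  open ≤-Reasoning
  xs⊆as++bs : xs ⊆ as ++ bs
  xs⊆as++bs {z} z∈xs with ∈-++⁻ as (xs⊆ys (there z∈xs))
  ... | inj₁ z∈as         = ∈-++⁺ˡ z∈as
  ... | inj₂ (here refl)  = ⊥-elim (All.lookup x∉xs z∈xs refl)
  ... | inj₂ (there z∈bs) = ∈-++⁺ʳ as z∈bs

fits-level : ∀ {d i} → i ≤ d → All (Fits {d}) (level i)
fits-level {d} i≤d = All.tabulate (λ {w} w∈ → subst (_≤ d) (sym (∈-level⁻ _ w∈)) i≤d)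

fits-below : ∀ {d j} → j ≤ d → All (Fits {d}) (below j)
fits-below j≤d = All.tabulate (λ w∈ → <⇒≤ (<-≤-trans (∈-below⁻ _ w∈) j≤d))

topLevels : ∀ d j → List (Vertex d)
topLevels d j = map toVertex (below j)

module _ {d j : ℕ} (j<d : suc j ≤ d) where

  private
    S : List (Vertex d)
    S = topLevels d (suc j)

  ∉topLevels⇒deep : ∀ {w} → w ∉ S → suc j ≤ depth w
  ∉topLevels⇒deep w∉S = ≮⇒≥ (λ |w|≤j → w∉S (∈-map-toVertex⁺ (∈-below⁺ (suc j) |w|≤j)))

  deep⇒∉topLevels : ∀ {w} → suc j ≤ depth w → w ∉ S
  deep⇒∉topLevels j<|w| w∈S = <⇒≱ (∈-below⁻ (suc j) (∈-map-toVertex⁻ (fits-below j<d) w∈S)) j<|w|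

  ~⇔depth≡ : ∀ u w → suc j ≤ depth u → (w ∉ S × w ~⟨ S ⟩ u) ⇔ depth w ≡ depth u
  ~⇔depth≡ u w j<|u| = mk⇔
    (λ (w∉S , w~u) → ↭-below⇒length≡ j (proj₁ w) (proj₁ u) (∉topLevels⇒deep w∉S) j<|u|
                       (subst₂ _↭_ (m-map-toVertex w fits) (m-map-toVertex u fits) w~u))
    (λ |w|≡|u| → deep⇒∉topLevels (subst (suc j ≤_) (sym |w|≡|u|) j<|u|)
               , subst₂ _↭_ (sym (m-map-toVertex w fits)) (sym (m-map-toVertex u fits))
                   (map-wordDist-below-↭ (suc j) (proj₁ w) (proj₁ u) |w|≡|u|))
    where
    fits : All Fits (below (suc j))
    fits = fits-below j<d

  classOf : Vertex d → List (Vertex d)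
  classOf u = map toVertex (level (depth u))

  ∈-classOf⇔ : ∀ u w → suc j ≤ depth u → w ∈ classOf u ⇔ (w ∉ S × w ~⟨ S ⟩ u)
  ∈-classOf⇔ u@(_ , |u|≤d) w j<|u| = ⇔-sym (~⇔depth≡ u w j<|u|) ⇔-∘ mk⇔
    (∈-level⁻ (depth u) ∘ ∈-map-toVertex⁻ (fits-level |u|≤d))
    (λ |w|≡|u| → subst (λ t → w ∈ map toVertex (level t)) |w|≡|u| (∈-map-toVertex⁺ (∈-level⁺ (proj₁ w))))

  Unique-classOf : ∀ u → Unique (classOf u)
  Unique-classOf u@(_ , |u|≤d) = Unique-map-toVertex (fits-level |u|≤d) (Unique-level (depth u))

  length-classOf : ∀ u → length (classOf u) ≡ 2 ^ depth u
  length-classOf u = trans (length-map toVertex (level (depth u))) (length-level (depth u))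

  classSize-deep : ∀ u → suc j ≤ depth u → ClassSize S u (2 ^ depth u)
  classSize-deep u j<|u| = classOf u , Unique-classOf u , (λ w → ∈-classOf⇔ u w j<|u|) , length-classOf u

  classSize-≥ : ∀ u n → u ∉ S → ClassSize S u n → 2 ^ suc j ≤ n
  classSize-≥ u _ u∉S (C , uniqC , ∈C⇔ , refl) = begin
    2 ^ suc j           ≤⟨ ^-monoʳ-≤ 2 j<|u| ⟩
    2 ^ depth u         ≡⟨ length-classOf u ⟨
    length (classOf u)  ≤⟨ Unique-⊆⇒length≤ (Unique-classOf u)
                             (λ {w} → Equivalence.from (∈C⇔ w) ∘ Equivalence.to (∈-classOf⇔ u w j<|u|)) ⟩
    length C            ∎
    where
    open ≤-Reasoning
    j<|u| : suc j ≤ depth u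
    j<|u| = ∉topLevels⇒deep u∉S

  topLevels-isMARS : IsMARS d (2 ^ suc j) (topLevels d (suc j))
  topLevels-isMARS =
    Unique-map-toVertex (fits-below j<d) (Unique-below (suc j)) ,
    (([] , z≤n) , ∈-map-toVertex⁺ (∈-below⁺ (suc j) (s≤s z≤n))) ,
    (u₀ , u₀∉S) ,
    (u₀ , u₀∉S , subst (ClassSize S u₀) (cong (2 ^_) |u₀|≡) (classSize-deep u₀ j<|u₀|)) ,
    classSize-≥
    where
    |u₀|≡ : length (replicate (suc j) false) ≡ suc j
    |u₀|≡ = length-replicate (suc j)
    u₀ : Vertex d
    u₀ = replicate (suc j) false , subst (_≤ d) (sym |u₀|≡) j<d
    j<|u₀| : suc j ≤ depth u₀
    j<|u₀| = ≤-reflexive (sym |u₀|≡)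
    u₀∉S : u₀ ∉ S
    u₀∉S = deep⇒∉topLevels j<|u₀|

proposition14 : ∀ (d j : ℕ) → 2 ≤ d → 1 ≤ j → j ≤ d →
    msad≤ d (2 ^ j) (geomSum d j)
proposition14 d (suc j) 2≤d _ j<d = topLevels d (suc j) , topLevels-isMARS j<d , (begin
  length (topLevels d (suc j))  ≡⟨ length-map toVertex (below (suc j)) ⟩
  length (below (suc j))        ≡⟨ length-below (suc j) ⟩
  geomSum 2 (suc j)             ≤⟨ geomSum-monoˡ-≤ (suc j) 2≤d ⟩
  geomSum d (suc j)             ∎)
  where open ≤-Reasoning
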